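{- Let $\mathbf{CAs}=\{\mathbf{CAs}^{(\gamma)}:\gamma\ge1\}$ and define $\mathbf{CAs}^{(\gamma)}\preceq_{\mathrm{d}}\mathbf{CAs}^{(\gamma')}$ if and only if there exists an operad morphism $\mathbf{CAs}^{(\gamma')}\to\mathbf{CAs}^{(\gamma)}$. Then $\preceq_{\mathrm{d}}$ is a partial order relation on $\mathbf{CAs}$.
   Context: A binary tree is either the leaf or an ordered pair of binary trees. $\mathbf{Mag}$ is the nonsymmetric set-theoretic operad of binary trees ($\mathbf{Mag}(n)$ = trees with $n$ leaves), with $\mathfrak{t}\circ_i\mathfrak{s}$ grafting the root of $\mathfrak{s}$ onto the $i$-th leaf of $\mathfrak{t}$. Combs: $\mathrm{LComb}_1=\mathrm{RComb}_1=(\text{leaf},\text{leaf})$, $\mathrm{LComb}_d=(\mathrm{LComb}_{d-1},\text{leaf})$, $\mathrm{RComb}_d=(\text{leaf},\mathrm{RComb}_{d-1})$. For $\gamma\ge1$, $\equiv_\gamma$ is the smallest operad congruence on $\mathbf{Mag}$ with $\mathrm{LComb}_\gamma\equiv_\gamma\mathrm{RComb}_\gamma$, and $\mathbf{CAs}^{(\gamma)}:=\mathbf{Mag}/_{\equiv_\gamma}$. An operad morphism is an arity-preserving map sending unit to unit and commuting with partial compositions. -}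

module Defs where

open import Data.Nat using (ℕ; zero; suc; _+_; _∸_; _<_; _<ᵇ_)
open import Data.Bool using (if_then_else_)
open import Data.Product using (Σ; _×_)
open import Relation.Binary.PropositionalEquality using (_≡_)

data Tree : Set where
  leaf : Tree
  node : Tree → Tree → Tree

-- Number of leaves (the arity in Mag).
leaves : Tree → ℕ
leaves leaf       = 1
leaves (node l r) = leaves l + leaves r

-- Partial composition of Mag: graft t i s grafts the root of s onto the
-- leaf of t at 0-based position i (i.e. t ∘_{i+1} s).  Only meaningful
-- for i < leaves t; out-of-range positions are junk and never used.
graft : Tree → ℕ → Tree → Tree
graft leaf zero    s = s
graft leaf (suc i) s = leaf
graft (node l r) i s =
  if i <ᵇ leaves l then node (graft l i s) r
  else node l (graft r (i ∸ leaves l) s)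

LComb : ℕ → Tree
LComb zero    = leaf
LComb (suc d) = node (LComb d) leaf

RComb : ℕ → Tree
RComb zero    = leaf
RComb (suc d) = node leaf (RComb d)

-- ≡_γ : the smallest operad congruence on Mag with LComb γ ≡ RComb γ
-- (equivalence relation compatible with all partial compositions).
data _≈[_]_ : Tree → ℕ → Tree → Set where
  gen   : ∀ {γ} → LComb γ ≈[ γ ] RComb γ
  ≈refl : ∀ {γ t} → t ≈[ γ ] t
  ≈sym  : ∀ {γ t u} → t ≈[ γ ] u → u ≈[ γ ] t
  ≈trans : ∀ {γ t u v} → t ≈[ γ ] u → u ≈[ γ ] v → t ≈[ γ ] v
  ≈comp : ∀ {γ t t′ s s′} (i : ℕ) → i < leaves t →
          t ≈[ γ ] t′ → s ≈[ γ ] s′ → graft t i s ≈[ γ ] graft t′ i s′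

-- An operad morphism CAs^(γ) → CAs^(δ), presented (setoid-style, since
-- Agda has no quotient types) by a map on representatives that respects
-- ≡_γ / ≡_δ, preserves arity, sends the unit to the unit and commutes
-- with partial compositions (up to ≡_δ).
record OperadMorphism (γ δ : ℕ) : Set where
  field
    map       : Tree → Tree
    respects  : ∀ {t u} → t ≈[ γ ] u → map t ≈[ δ ] map u
    arity     : ∀ t → leaves (map t) ≡ leaves t
    unit      : map leaf ≈[ δ ] leaf
    comp      : ∀ t i s → i < leaves t →
                map (graft t i s) ≈[ δ ] graft (map t) i (map s)

_⪯d_ : ℕ → ℕ → Set
γ ⪯d γ′ = OperadMorphism γ′ γ

module Submission where

-- An operad morphism CAs^(γ′) → CAs^(γ) fixes the binary generator, the only
-- tree with two leaves; since every tree is built from it by grafting, the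
-- morphism is ≡_γ-equivalent to the identity, and so it exists only if
-- LComb γ′ ≡_γ RComb γ′.  The relation ≡_γ never identifies two distinct
-- trees with at most γ leaves (each of its generating steps involves trees
-- with at least γ + 1 leaves), and ≡_1 is plain equality.  Hence related
-- combs of degree γ′ ≥ 2 force 2 ≤ γ ≤ γ′, which gives antisymmetry; the
-- identity and composites of morphisms give reflexivity and transitivity.

open import Defs
open import Data.Nat using (ℕ; zero; suc; _+_; _∸_; _≤_; _<_; _<ᵇ_; z≤n; s≤s; s≤s⁻¹)
open import Data.Nat.Properties
open import Data.Bool using (true; false; T)
open import Data.Product using (_×_; _,_; proj₁; proj₂)
open import Level using (0ℓ)
open import Relation.Binary using (Setoid; IsEquivalence)
open import Relation.Nullary using (¬_; contradiction)
open import Relation.Binary.PropositionalEquality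
  using (_≡_; refl; sym; trans; cong; cong₂; subst; module ≡-Reasoning)
import Relation.Binary.Reasoning.Setoid as SetoidReasoning

open OperadMorphism

cherry : Tree
cherry = node leaf leaf

0<leaves : ∀ t → 0 < leaves t
0<leaves leaf       = s≤s z≤n
0<leaves (node l r) = ≤-trans (0<leaves l) (m≤m+n (leaves l) (leaves r))

2≤leaves-node : ∀ l r → 2 ≤ leaves (node l r)
2≤leaves-node l r = +-mono-≤ (0<leaves l) (0<leaves r)

leaves≡2⇒cherry : ∀ t → leaves t ≡ 2 → t ≡ cherry
leaves≡2⇒cherry (node leaf leaf)         _ = refl
leaves≡2⇒cherry (node leaf (node a b))   e =
  contradiction (subst (3 ≤_) e (s≤s (2≤leaves-node a b))) 1+n≰n
leaves≡2⇒cherry (node (node a b) r)      e =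
  contradiction (subst (3 ≤_) e (+-mono-≤ (2≤leaves-node a b) (0<leaves r))) 1+n≰n

leaves-LComb : ∀ d → leaves (LComb d) ≡ suc d
leaves-LComb zero    = refl
leaves-LComb (suc d) = trans (+-comm (leaves (LComb d)) 1) (cong suc (leaves-LComb d))

leaves-RComb : ∀ d → leaves (RComb d) ≡ suc d
leaves-RComb zero    = refl
leaves-RComb (suc d) = cong suc (leaves-RComb d)

LComb≢RComb : ∀ {d} → 2 ≤ d → ¬ LComb d ≡ RComb d
LComb≢RComb {suc zero}    (s≤s ())
LComb≢RComb {suc (suc _)} _ ()

<ᵇ≡true⇒< : ∀ m n → (m <ᵇ n) ≡ true → m < n
<ᵇ≡true⇒< m n eq = <ᵇ⇒< m n (subst T (sym eq) _)

<ᵇ≡false⇒≥ : ∀ m n → (m <ᵇ n) ≡ false → n ≤ m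
<ᵇ≡false⇒≥ m n eq = ≮⇒≥ (λ m<n → subst T eq (<⇒<ᵇ m<n))

leaves-graft : ∀ t i s → i < leaves t → leaves t + leaves s ≡ suc (leaves (graft t i s))
leaves-graft leaf       zero    s _ = refl
leaves-graft leaf       (suc i) s (s≤s ())
leaves-graft (node l r) i       s i<t with i <ᵇ leaves l in eq
... | true = begin
  leaves l + leaves r + leaves s   ≡⟨ +-assoc (leaves l) (leaves r) (leaves s) ⟩
  leaves l + (leaves r + leaves s) ≡⟨ cong (leaves l +_) (+-comm (leaves r) (leaves s)) ⟩
  leaves l + (leaves s + leaves r) ≡⟨ +-assoc (leaves l) (leaves s) (leaves r) ⟨
  leaves l + leaves s + leaves r   ≡⟨ cong (_+ leaves r) (leaves-graft l i s i<l) ⟩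
  suc (leaves (graft l i s) + leaves r) ∎
  where
  open ≡-Reasoning
  i<l : i < leaves l
  i<l = <ᵇ≡true⇒< i (leaves l) eq
... | false = begin
  leaves l + leaves r + leaves s   ≡⟨ +-assoc (leaves l) (leaves r) (leaves s) ⟩
  leaves l + (leaves r + leaves s) ≡⟨ cong (leaves l +_) (leaves-graft r j s j<r) ⟩
  leaves l + suc (leaves (graft r j s)) ≡⟨ +-suc (leaves l) _ ⟩
  suc (leaves l + leaves (graft r j s)) ∎
  where
  open ≡-Reasoning
  j = i ∸ leaves l
  j<r : j < leaves r
  j<r = subst (j <_) (m+n∸m≡n (leaves l) (leaves r))
          (∸-monoˡ-< i<t (<ᵇ≡false⇒≥ i (leaves l) eq))

leaves≤leaves-graftˡ : ∀ t i s → i < leaves t → leaves t ≤ leaves (graft t i s)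
leaves≤leaves-graftˡ t i s i<t =
  s≤s⁻¹ (subst (suc (leaves t) ≤_) (leaves-graft t i s i<t) (m<m+n (leaves t) (0<leaves s)))

leaves≤leaves-graftʳ : ∀ t i s → i < leaves t → leaves s ≤ leaves (graft t i s)
leaves≤leaves-graftʳ t i s i<t =
  s≤s⁻¹ (subst (suc (leaves s) ≤_) (leaves-graft t i s i<t) (m<n+m (leaves s) (0<leaves t)))

≈-isEquivalence : ∀ γ → IsEquivalence (λ t u → t ≈[ γ ] u)
≈-isEquivalence γ = record { refl = ≈refl ; sym = ≈sym ; trans = ≈trans }

≈-setoid : ℕ → Setoid 0ℓ 0ℓ
≈-setoid γ = record { isEquivalence = ≈-isEquivalence γ }

module ≈-Reasoning {γ} = SetoidReasoning (≈-setoid γ)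

≈-leaves : ∀ {γ t u} → t ≈[ γ ] u → leaves t ≡ leaves u
≈-leaves {γ} gen = trans (leaves-LComb γ) (sym (leaves-RComb γ))
≈-leaves ≈refl = refl
≈-leaves (≈sym p) = sym (≈-leaves p)
≈-leaves (≈trans p q) = trans (≈-leaves p) (≈-leaves q)
≈-leaves (≈comp {t = t} {t′} {s} {s′} i i<t p q) = suc-injective (begin
  suc (leaves (graft t i s))   ≡⟨ leaves-graft t i s i<t ⟨
  leaves t + leaves s          ≡⟨ cong₂ _+_ (≈-leaves p) (≈-leaves q) ⟩
  leaves t′ + leaves s′        ≡⟨ leaves-graft t′ i s′ (subst (i <_) (≈-leaves p) i<t) ⟩
  suc (leaves (graft t′ i s′)) ∎)
  where open ≡-Reasoning

≈⇒≡-small : ∀ {γ t u} → leaves t ≤ γ → t ≈[ γ ] u → t ≡ u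
≈⇒≡-small {γ} small gen = contradiction (subst (_≤ γ) (leaves-LComb γ) small) 1+n≰n
≈⇒≡-small small ≈refl = refl
≈⇒≡-small small (≈sym p) = sym (≈⇒≡-small (subst (_≤ _) (sym (≈-leaves p)) small) p)
≈⇒≡-small small (≈trans p q) with refl ← ≈⇒≡-small small p = ≈⇒≡-small small q
≈⇒≡-small small (≈comp {t = t} {s = s} i i<t p q) =
  cong₂ (λ t s → graft t i s)
    (≈⇒≡-small (≤-trans (leaves≤leaves-graftˡ t i s i<t) small) p)
    (≈⇒≡-small (≤-trans (leaves≤leaves-graftʳ t i s i<t) small) q)

≈⇒≡-trivial : ∀ {γ t u} → LComb γ ≡ RComb γ → t ≈[ γ ] u → t ≡ u
≈⇒≡-trivial trivial gen = trivial
≈⇒≡-trivial trivial ≈refl = refl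
≈⇒≡-trivial trivial (≈sym p) = sym (≈⇒≡-trivial trivial p)
≈⇒≡-trivial trivial (≈trans p q) = trans (≈⇒≡-trivial trivial p) (≈⇒≡-trivial trivial q)
≈⇒≡-trivial trivial (≈comp i _ p q) =
  cong₂ (λ t s → graft t i s) (≈⇒≡-trivial trivial p) (≈⇒≡-trivial trivial q)

combs-≈⇒2≤γ≤d : ∀ {γ d} → 2 ≤ d → LComb d ≈[ γ ] RComb d → 2 ≤ γ × γ ≤ d
combs-≈⇒2≤γ≤d {zero}        2≤d p = contradiction (≈⇒≡-trivial refl p) (LComb≢RComb 2≤d)
combs-≈⇒2≤γ≤d {suc zero}    2≤d p = contradiction (≈⇒≡-trivial refl p) (LComb≢RComb 2≤d)
combs-≈⇒2≤γ≤d {suc (suc k)} {d} 2≤d p = s≤s (s≤s z≤n) , ≮⇒≥ d<γ-absurd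
  where
  d<γ-absurd : ¬ d < suc (suc k)
  d<γ-absurd d<γ =
    LComb≢RComb 2≤d (≈⇒≡-small (subst (_≤ suc (suc k)) (sym (leaves-LComb d)) d<γ) p)

combs-≈-antisym : ∀ {γ γ′} → 1 ≤ γ → 1 ≤ γ′ →
                  LComb γ′ ≈[ γ ] RComb γ′ → LComb γ ≈[ γ′ ] RComb γ → γ ≡ γ′
combs-≈-antisym {suc zero}    {suc zero}    _ _ _ _ = refl
combs-≈-antisym {suc zero}    {suc (suc _)} _ _ p _ =
  contradiction (proj₁ (combs-≈⇒2≤γ≤d (s≤s (s≤s z≤n)) p)) (<-irrefl refl)
combs-≈-antisym {suc (suc _)} {suc zero}    _ _ _ q =
  contradiction (proj₁ (combs-≈⇒2≤γ≤d (s≤s (s≤s z≤n)) q)) (<-irrefl refl)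
combs-≈-antisym {suc (suc _)} {suc (suc _)} _ _ p q =
  ≤-antisym (proj₂ (combs-≈⇒2≤γ≤d (s≤s (s≤s z≤n)) p))
            (proj₂ (combs-≈⇒2≤γ≤d (s≤s (s≤s z≤n)) q))

idᴹ : ∀ {γ} → OperadMorphism γ γ
idᴹ = record
  { map      = λ t → t
  ; respects = λ p → p
  ; arity    = λ _ → refl
  ; unit     = ≈refl
  ; comp     = λ _ _ _ _ → ≈refl
  }

_∘ᴹ_ : ∀ {α β γ} → OperadMorphism β γ → OperadMorphism α β → OperadMorphism α γ
f ∘ᴹ g = record
  { map      = λ t → map f (map g t)
  ; respects = λ p → respects f (respects g p)
  ; arity    = λ t → trans (arity f (map g t)) (arity g t)
  ; unit     = ≈trans (respects f (unit g)) (unit f)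
  ; comp     = λ t i s i<t → ≈trans (respects f (comp g t i s i<t))
                 (comp f (map g t) i (map g s) (subst (i <_) (sym (arity g t)) i<t))
  }

map-cherry : ∀ {γ δ} (f : OperadMorphism γ δ) → map f cherry ≡ cherry
map-cherry f = leaves≡2⇒cherry _ (arity f cherry)

-- node l r is definitionally graft (graft cherry 1 r) 0 l.
map≈id : ∀ {γ δ} (f : OperadMorphism γ δ) t → map f t ≈[ δ ] t
map≈id f leaf       = unit f
map≈id f (node l r) = begin
  map f (node l r)
    ≈⟨ comp f (graft cherry 1 r) 0 l (s≤s z≤n) ⟩
  graft (map f (graft cherry 1 r)) 0 (map f l)
    ≈⟨ ≈comp {t = map f (graft cherry 1 r)} 0 (0<leaves (map f (graft cherry 1 r)))
         (comp f cherry 1 r (s≤s (s≤s z≤n))) (map≈id f l) ⟩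
  graft (graft (map f cherry) 1 (map f r)) 0 l
    ≡⟨ cong (λ c → graft (graft c 1 (map f r)) 0 l) (map-cherry f) ⟩
  graft (graft cherry 1 (map f r)) 0 l
    ≈⟨ ≈comp {t = graft cherry 1 (map f r)} 0 (s≤s z≤n)
         (≈comp {t = cherry} 1 (s≤s (s≤s z≤n)) ≈refl (map≈id f r)) ≈refl ⟩
  node l r ∎
  where open ≈-Reasoning

morphism⇒combs-≈ : ∀ {γ γ′} → OperadMorphism γ′ γ → LComb γ′ ≈[ γ ] RComb γ′
morphism⇒combs-≈ f = begin
  LComb _         ≈⟨ map≈id f _ ⟨
  map f (LComb _) ≈⟨ respects f gen ⟩
  map f (RComb _) ≈⟨ map≈id f _ ⟩
  RComb _         ∎
  where open ≈-Reasoning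

proposition3p2p5 :
    (∀ γ → 1 ≤ γ → γ ⪯d γ)
    × (∀ γ γ′ γ″ → 1 ≤ γ → 1 ≤ γ′ → 1 ≤ γ″ → γ ⪯d γ′ → γ′ ⪯d γ″ → γ ⪯d γ″)
    × (∀ γ γ′ → 1 ≤ γ → 1 ≤ γ′ → γ ⪯d γ′ → γ′ ⪯d γ → γ ≡ γ′)
proposition3p2p5 =
    (λ _ _ → idᴹ)
  , (λ _ _ _ _ _ _ f g → f ∘ᴹ g)
  , λ _ _ 1≤γ 1≤γ′ f g →
      combs-≈-antisym 1≤γ 1≤γ′ (morphism⇒combs-≈ f) (morphism⇒combs-≈ g)
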